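{- For every integer $i \geq 0$, $\chi_{\bar{2}}(9 \cdot 2^{i}-1) \leq 13\cdot 2^i$.
   Context: $\chi_{\bar{2}}(n)$ denotes the chromatic number of the graph $Q_n^2$, whose vertex set is $\mathbb{Z}_2^n$ (binary words of length $n$) and in which two distinct words are adjacent exactly when their Hamming distance is at most $2$ (the square of the $n$-dimensional hypercube). -}

module Defs where

open import Data.Bool using (Bool; true; false; _xor_)
open import Data.Nat using (ℕ; zero; suc; _+_; _≤_)
open import Data.Fin using (Fin)
open import Data.Vec using (Vec; []; _∷_)
open import Data.Product using (∃)
open import Relation.Binary.PropositionalEquality using (_≡_)
open import Relation.Nullary using (¬_)

Word : ℕ → Set
Word n = Vec Bool n

hamming : ∀ {n} → Word n → Word n → ℕ
hamming [] [] = 0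
hamming (x ∷ xs) (y ∷ ys) with x xor y
... | true  = suc (hamming xs ys)
... | false = hamming xs ys

Adjacent : ∀ {n} → Word n → Word n → Set
Adjacent u v = ¬ (u ≡ v) × hamming u v ≤ 2
  where open import Data.Product using (_×_)

IsProperColouring : ∀ n k → (Word n → Fin k) → Set
IsProperColouring n k c = ∀ u v → Adjacent u v → ¬ (c u ≡ c v)

χ₂≤ : ℕ → ℕ → Set
χ₂≤ n k = ∃ λ (c : Word n → Fin k) → IsProperColouring n k c

-- Doubling: if c properly colours Q_n^2 with k colours, colour the word (b, u, v) of length
-- 1 + n + n by the pair (b + |u| mod 2, c (u + v)), a proper 2k-colouring of Q_(2n+1)^2.
-- Two words at distance ≤ 2 with the same colour have sums u + v and u′ + v′ at distance
-- ≤ 2, hence equal sums; then u + u′ = v + v′ = e, so the words differ by (β, e, e) with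
-- β ≡ |e| mod 2, and the weight β + 2|e| of that difference is either 0 or at least 3.
-- Starting from an explicit 13-colouring of Q_8^2, the recursion 9·2^(i+1) − 1 = 2(9·2^i − 1) + 1
-- gives the bound.
module Submission where

open import Defs
open import Algebra.Bundles using (CommutativeRing)
open import Data.Bool using (Bool; true; false; not; _xor_)
open import Data.Bool.Properties
  using (xor-∧-commutativeRing; xor-same; xor-annihilates-not; not-distribˡ-xor; not-distribʳ-xor)
  renaming (_≟_ to _≟ᵇ_)
open import Data.Fin using (Fin; combine; #_)
open import Data.Fin.Properties using (2↔Bool; combine-injective) renaming (_≟_ to _≟ᶠ_)
open import Data.Nat using (ℕ; zero; suc; _+_; _*_; _∸_; _^_; _≤_; _<_; z≤n; s≤s; NonZero)
open import Data.Nat.Properties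
  using (+-suc; +-identityʳ; +-mono-≤; n≤1+n; m≤n+m; m+n≤o⇒n≤o; ≤-trans; ≤-pred;
         *-assoc; *-comm; m*n≢0; m^n≢0; module ≤-Reasoning)
open import Data.Product using (_×_; _,_; proj₁; proj₂)
open import Data.Vec using (Vec; []; _∷_; _++_; zipWith; take; drop)
open import Data.Vec.Properties using (≡-dec; take++drop≡id)
open import Function using (_∘_)
open import Function.Bundles using (Injection; _↣_)
open import Function.Properties.Inverse using (↔-sym; ↔⇒↣)
open import Relation.Binary.PropositionalEquality
  using (_≡_; refl; sym; trans; cong; cong₂; subst; subst₂; module ≡-Reasoning)
open import Relation.Nullary using (Dec; yes; ¬?; contradiction)
open import Relation.Nullary.Decidable using (map′; _×-dec_; _→-dec_; toWitness; decidable-stable)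
open import Relation.Unary using (Decidable)

open CommutativeRing xor-∧-commutativeRing using (+-commutativeSemigroup)
open import Algebra.Properties.CommutativeSemigroup +-commutativeSemigroup
  using () renaming (interchange to xor-interchange)

private
  variable
    m n k : ℕ

infixl 6 _⊕_

_⊕_ : Word n → Word n → Word n
_⊕_ = zipWith _xor_

bit : Bool → ℕ
bit false = 0
bit true  = 1

weight : Word n → ℕ
weight []      = 0
weight (x ∷ u) = bit x + weight u

odd : ℕ → Bool
odd zero    = false
odd (suc m) = not (odd m)

hamming-∷ : (x y : Bool) (u v : Word n) → hamming (x ∷ u) (y ∷ v) ≡ bit (x xor y) + hamming u v
hamming-∷ true  true  u v = refl
hamming-∷ true  false u v = refl
hamming-∷ false true  u v = refl
hamming-∷ false false u v = refl

hamming≡weight-⊕ : (u v : Word n) → hamming u v ≡ weight (u ⊕ v)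
hamming≡weight-⊕ []      []      = refl
hamming≡weight-⊕ (x ∷ u) (y ∷ v) =
  trans (hamming-∷ x y u v) (cong (bit (x xor y) +_) (hamming≡weight-⊕ u v))

hamming-refl : (u : Word n) → hamming u u ≡ 0
hamming-refl []          = refl
hamming-refl (true  ∷ u) = hamming-refl u
hamming-refl (false ∷ u) = hamming-refl u

hamming≡0⇒≡ : (u v : Word n) → hamming u v ≡ 0 → u ≡ v
hamming≡0⇒≡ []          []          _ = refl
hamming≡0⇒≡ (true  ∷ u) (true  ∷ v) d = cong (true ∷_) (hamming≡0⇒≡ u v d)
hamming≡0⇒≡ (false ∷ u) (false ∷ v) d = cong (false ∷_) (hamming≡0⇒≡ u v d)
hamming≡0⇒≡ (true  ∷ u) (false ∷ v) ()
hamming≡0⇒≡ (false ∷ u) (true  ∷ v) ()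

hamming-++ : (u u′ : Word m) (v v′ : Word n) → hamming (u ++ v) (u′ ++ v′) ≡ hamming u u′ + hamming v v′
hamming-++ []          []           v v′ = refl
hamming-++ (true  ∷ u) (true  ∷ u′) v v′ = hamming-++ u u′ v v′
hamming-++ (true  ∷ u) (false ∷ u′) v v′ = cong suc (hamming-++ u u′ v v′)
hamming-++ (false ∷ u) (true  ∷ u′) v v′ = cong suc (hamming-++ u u′ v v′)
hamming-++ (false ∷ u) (false ∷ u′) v v′ = hamming-++ u u′ v v′

weight-⊕-≤ : (u v : Word n) → weight (u ⊕ v) ≤ weight u + weight v
weight-⊕-≤ []          []          = z≤n
weight-⊕-≤ (true  ∷ u) (true  ∷ v) = ≤-trans (weight-⊕-≤ u v) (+-mono-≤ (n≤1+n _) (n≤1+n _))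
weight-⊕-≤ (true  ∷ u) (false ∷ v) = s≤s (weight-⊕-≤ u v)
weight-⊕-≤ (false ∷ u) (true  ∷ v) =
  subst (suc (weight (u ⊕ v)) ≤_) (sym (+-suc (weight u) (weight v))) (s≤s (weight-⊕-≤ u v))
weight-⊕-≤ (false ∷ u) (false ∷ v) = weight-⊕-≤ u v

odd-weight-⊕ : (u v : Word n) → odd (weight (u ⊕ v)) ≡ odd (weight u) xor odd (weight v)
odd-weight-⊕ []          []          = refl
odd-weight-⊕ (true  ∷ u) (true  ∷ v) =
  trans (odd-weight-⊕ u v) (sym (xor-annihilates-not (odd (weight u)) (odd (weight v))))
odd-weight-⊕ (true  ∷ u) (false ∷ v) =
  trans (cong not (odd-weight-⊕ u v)) (not-distribˡ-xor (odd (weight u)) (odd (weight v)))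
odd-weight-⊕ (false ∷ u) (true  ∷ v) =
  trans (cong not (odd-weight-⊕ u v)) (not-distribʳ-xor (odd (weight u)) (odd (weight v)))
odd-weight-⊕ (false ∷ u) (false ∷ v) = odd-weight-⊕ u v

odd-hamming : (u v : Word n) → odd (hamming u v) ≡ odd (weight u) xor odd (weight v)
odd-hamming u v = trans (cong odd (hamming≡weight-⊕ u v)) (odd-weight-⊕ u v)

⊕-interchange : (u v u′ v′ : Word n) → (u ⊕ v) ⊕ (u′ ⊕ v′) ≡ (u ⊕ u′) ⊕ (v ⊕ v′)
⊕-interchange []      []      []        []        = refl
⊕-interchange (a ∷ u) (b ∷ v) (a′ ∷ u′) (b′ ∷ v′) =
  cong₂ _∷_ (xor-interchange a b a′ b′) (⊕-interchange u v u′ v′)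

hamming-⊕-interchange : (u v u′ v′ : Word n) → hamming (u ⊕ v) (u′ ⊕ v′) ≡ hamming (u ⊕ u′) (v ⊕ v′)
hamming-⊕-interchange u v u′ v′ = begin
  hamming (u ⊕ v) (u′ ⊕ v′)     ≡⟨ hamming≡weight-⊕ (u ⊕ v) (u′ ⊕ v′) ⟩
  weight ((u ⊕ v) ⊕ (u′ ⊕ v′))  ≡⟨ cong weight (⊕-interchange u v u′ v′) ⟩
  weight ((u ⊕ u′) ⊕ (v ⊕ v′))  ≡⟨ sym (hamming≡weight-⊕ (u ⊕ u′) (v ⊕ v′)) ⟩
  hamming (u ⊕ u′) (v ⊕ v′)     ∎
  where open ≡-Reasoning

hamming-⊕-≤ : (u v u′ v′ : Word n) → hamming (u ⊕ v) (u′ ⊕ v′) ≤ hamming u u′ + hamming v v′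
hamming-⊕-≤ u v u′ v′ = begin
  hamming (u ⊕ v) (u′ ⊕ v′)                ≡⟨ hamming-⊕-interchange u v u′ v′ ⟩
  hamming (u ⊕ u′) (v ⊕ v′)                ≡⟨ hamming≡weight-⊕ (u ⊕ u′) (v ⊕ v′) ⟩
  weight ((u ⊕ u′) ⊕ (v ⊕ v′))             ≤⟨ weight-⊕-≤ (u ⊕ u′) (v ⊕ v′) ⟩
  weight (u ⊕ u′) + weight (v ⊕ v′)        ≡⟨ sym (cong₂ _+_ (hamming≡weight-⊕ u u′) (hamming≡weight-⊕ v v′)) ⟩
  hamming u u′ + hamming v v′              ∎
  where open ≤-Reasoning

⊕≡⇒hamming≡ : (u v u′ v′ : Word n) → u ⊕ v ≡ u′ ⊕ v′ → hamming u u′ ≡ hamming v v′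
⊕≡⇒hamming≡ u v u′ v′ eq = begin
  hamming u u′        ≡⟨ hamming≡weight-⊕ u u′ ⟩
  weight (u ⊕ u′)     ≡⟨ cong weight (hamming≡0⇒≡ (u ⊕ u′) (v ⊕ v′) differences-agree) ⟩
  weight (v ⊕ v′)     ≡⟨ sym (hamming≡weight-⊕ v v′) ⟩
  hamming v v′        ∎
  where
  open ≡-Reasoning
  differences-agree : hamming (u ⊕ u′) (v ⊕ v′) ≡ 0
  differences-agree = begin
    hamming (u ⊕ u′) (v ⊕ v′)  ≡⟨ sym (hamming-⊕-interchange u v u′ v′) ⟩
    hamming (u ⊕ v) (u′ ⊕ v′)  ≡⟨ cong (hamming (u ⊕ v)) (sym eq) ⟩
    hamming (u ⊕ v) (u ⊕ v)    ≡⟨ hamming-refl (u ⊕ v) ⟩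
    0                          ∎

even∧weight≤2⇒weight≡0 : ∀ β w → odd (bit β + w) ≡ false → bit β + (w + w) ≤ 2 → bit β + (w + w) ≡ 0
even∧weight≤2⇒weight≡0 false zero          _  _                    = refl
even∧weight≤2⇒weight≡0 true  zero          () _
even∧weight≤2⇒weight≡0 false (suc zero)    () _
even∧weight≤2⇒weight≡0 true  (suc zero)    _  (s≤s (s≤s ()))
even∧weight≤2⇒weight≡0 false (suc (suc w)) _  (s≤s (s≤s too-big)) = contradiction (m+n≤o⇒n≤o w too-big) λ ()
even∧weight≤2⇒weight≡0 true  (suc (suc w)) _  (s≤s (s≤s ()))

Bool↣Fin2 : Bool ↣ Fin 2
Bool↣Fin2 = ↔⇒↣ (↔-sym 2↔Bool)

doubledColour : (Word n → Fin k) → Bool → Word n → Word n → Fin (2 * k)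
doubledColour c b u v = combine (Injection.to Bool↣Fin2 (odd (weight (b ∷ u)))) (c (u ⊕ v))

doubledColour-separates : {c : Word n → Fin k} → IsProperColouring n k c →
  ∀ b u v b′ u′ v′ → hamming (b ∷ u ++ v) (b′ ∷ u′ ++ v′) ≤ 2 →
  doubledColour c b u v ≡ doubledColour c b′ u′ v′ → hamming (b ∷ u ++ v) (b′ ∷ u′ ++ v′) ≡ 0
doubledColour-separates {c = c} proper b u v b′ u′ v′ close same =
  trans distance (even∧weight≤2⇒weight≡0 β (hamming u u′) even (subst (_≤ 2) distance close))
  where
  β p p′ : Bool
  β  = b xor b′
  p  = odd (weight (b ∷ u))
  p′ = odd (weight (b′ ∷ u′))
  same-components : Injection.to Bool↣Fin2 p ≡ Injection.to Bool↣Fin2 p′ × c (u ⊕ v) ≡ c (u′ ⊕ v′)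
  same-components = combine-injective (Injection.to Bool↣Fin2 p) (c (u ⊕ v))
                                      (Injection.to Bool↣Fin2 p′) (c (u′ ⊕ v′)) same
  split-distance : hamming (b ∷ u ++ v) (b′ ∷ u′ ++ v′) ≡ bit β + (hamming u u′ + hamming v v′)
  split-distance =
    trans (hamming-∷ b b′ (u ++ v) (u′ ++ v′)) (cong (bit β +_) (hamming-++ u u′ v v′))
  sums-close : hamming (u ⊕ v) (u′ ⊕ v′) ≤ 2
  sums-close =
    ≤-trans (hamming-⊕-≤ u v u′ v′) (≤-trans (m≤n+m _ (bit β)) (subst (_≤ 2) split-distance close))
  same-sum : u ⊕ v ≡ u′ ⊕ v′
  same-sum = decidable-stable (≡-dec _≟ᵇ_ (u ⊕ v) (u′ ⊕ v′))
               λ sums-differ → proper _ _ (sums-differ , sums-close) (proj₂ same-components)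
  distance : hamming (b ∷ u ++ v) (b′ ∷ u′ ++ v′) ≡ bit β + (hamming u u′ + hamming u u′)
  distance =
    trans split-distance (cong (λ h → bit β + (hamming u u′ + h)) (sym (⊕≡⇒hamming≡ u v u′ v′ same-sum)))
  even : odd (bit β + hamming u u′) ≡ false
  even = begin
    odd (bit β + hamming u u′)         ≡⟨ cong odd (sym (hamming-∷ b b′ u u′)) ⟩
    odd (hamming (b ∷ u) (b′ ∷ u′))    ≡⟨ odd-hamming (b ∷ u) (b′ ∷ u′) ⟩
    p xor p′                           ≡⟨ cong (_xor p′) (Injection.injective Bool↣Fin2 (proj₁ same-components)) ⟩
    p′ xor p′                          ≡⟨ xor-same p′ ⟩
    false                              ∎
    where open ≡-Reasoning

doubling : χ₂≤ n k → χ₂≤ (suc (n + n)) (2 * k)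
doubling {n} {k} (c , proper) = colour , colour-proper
  where
  colour : Word (suc (n + n)) → Fin (2 * k)
  colour (b ∷ r) = doubledColour c b (take n r) (drop n r)
  colour-proper : IsProperColouring (suc (n + n)) (2 * k) colour
  colour-proper (b ∷ r) (b′ ∷ r′) (x≢x′ , close) same =
    x≢x′ (trans (sym halves) (trans (hamming≡0⇒≡ _ _ separated) halves′))
    where
    halves : b ∷ take n r ++ drop n r ≡ b ∷ r
    halves = cong (b ∷_) (take++drop≡id n r)
    halves′ : b′ ∷ take n r′ ++ drop n r′ ≡ b′ ∷ r′
    halves′ = cong (b′ ∷_) (take++drop≡id n r′)
    separated : hamming (b ∷ take n r ++ drop n r) (b′ ∷ take n r′ ++ drop n r′) ≡ 0
    separated = doubledColour-separates proper b (take n r) (drop n r) b′ (take n r′) (drop n r′)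
                  (subst₂ (λ x x′ → hamming x x′ ≤ 2) (sym halves) (sym halves′) close) same

∀-word? : ∀ n {P : Word n → Set} → Decidable P → Dec (∀ u → P u)
∀-word? zero    P? = map′ (λ p → λ { [] → p }) (λ f → f []) (P? [])
∀-word? (suc n) P? = map′ (λ (f , t) → λ { (false ∷ u) → f u ; (true ∷ u) → t u })
                          (λ g → (λ u → g (false ∷ u)) , (λ u → g (true ∷ u)))
                          (∀-word? n (P? ∘ (false ∷_)) ×-dec ∀-word? n (P? ∘ (true ∷_)))

∀-within?  : ∀ d (u : Word n) {P : Word n → Set} → Decidable P → Dec (∀ v → hamming u v ≤ d → P v)
∀-within<? : ∀ d (u : Word n) {P : Word n → Set} → Decidable P → Dec (∀ v → hamming u v < d → P v)

∀-within? d []          P? = map′ (λ p → λ { [] _ → p }) (λ f → f [] z≤n) (P? [])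
∀-within? d (true  ∷ u) P? =
  map′ (λ (s , f) → λ { (true ∷ v) → s v ; (false ∷ v) → f v })
       (λ g → (λ v → g (true ∷ v)) , (λ v → g (false ∷ v)))
       (∀-within? d u (P? ∘ (true ∷_)) ×-dec ∀-within<? d u (P? ∘ (false ∷_)))
∀-within? d (false ∷ u) P? =
  map′ (λ (s , f) → λ { (false ∷ v) → s v ; (true ∷ v) → f v })
       (λ g → (λ v → g (false ∷ v)) , (λ v → g (true ∷ v)))
       (∀-within? d u (P? ∘ (false ∷_)) ×-dec ∀-within<? d u (P? ∘ (true ∷_)))

∀-within<? zero    u P? = yes λ _ ()
∀-within<? (suc d) u P? = map′ (λ f v → f v ∘ ≤-pred) (λ f v → f v ∘ s≤s) (∀-within? d u P?)

isProperColouring? : ∀ n k (c : Word n → Fin k) → Dec (IsProperColouring n k c)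
isProperColouring? n k c =
  map′ (λ f u v (u≢v , close) → f u v close u≢v) (λ f u v close u≢v → f u v (u≢v , close))
       (∀-word? n λ u → ∀-within? 2 u λ v → ¬? (≡-dec _≟ᵇ_ u v) →-dec ¬? (c u ≟ᶠ c v))

lookupWord : {A : Set} → Vec A (2 ^ n) → Word n → A
lookupWord {zero}  (x ∷ []) []          = x
lookupWord {suc n} t        (false ∷ u) = lookupWord (take (2 ^ n) t) u
lookupWord {suc n} t        (true  ∷ u) = lookupWord (take (2 ^ n) (drop (2 ^ n) t)) u

-- Row i, column j holds the colour of the word whose first and last four bits spell i and j
-- in binary, reading true as 1.
colours₈ : Vec (Vec (Fin 13) 16) 16
colours₈ =
  (# 4 ∷ # 2 ∷ # 11 ∷ # 8 ∷ # 10 ∷ # 7 ∷ # 12 ∷ # 9 ∷ # 6 ∷ # 11 ∷ # 2 ∷ # 1 ∷ # 3 ∷ # 0 ∷ # 4 ∷ # 5 ∷ []) ∷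
  (# 5 ∷ # 0 ∷ # 9 ∷ # 3 ∷ # 1 ∷ # 6 ∷ # 2 ∷ # 4 ∷ # 10 ∷ # 12 ∷ # 7 ∷ # 6 ∷ # 11 ∷ # 9 ∷ # 0 ∷ # 8 ∷ []) ∷
  (# 9 ∷ # 10 ∷ # 3 ∷ # 5 ∷ # 8 ∷ # 4 ∷ # 7 ∷ # 2 ∷ # 1 ∷ # 3 ∷ # 8 ∷ # 0 ∷ # 5 ∷ # 6 ∷ # 9 ∷ # 11 ∷ []) ∷
  (# 12 ∷ # 8 ∷ # 0 ∷ # 11 ∷ # 3 ∷ # 5 ∷ # 6 ∷ # 1 ∷ # 4 ∷ # 7 ∷ # 5 ∷ # 9 ∷ # 2 ∷ # 10 ∷ # 12 ∷ # 3 ∷ []) ∷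
  (# 3 ∷ # 5 ∷ # 7 ∷ # 0 ∷ # 11 ∷ # 12 ∷ # 8 ∷ # 6 ∷ # 9 ∷ # 4 ∷ # 5 ∷ # 12 ∷ # 1 ∷ # 2 ∷ # 10 ∷ # 3 ∷ []) ∷
  (# 2 ∷ # 11 ∷ # 4 ∷ # 1 ∷ # 9 ∷ # 10 ∷ # 3 ∷ # 5 ∷ # 0 ∷ # 3 ∷ # 8 ∷ # 10 ∷ # 5 ∷ # 7 ∷ # 6 ∷ # 11 ∷ []) ∷
  (# 0 ∷ # 7 ∷ # 2 ∷ # 4 ∷ # 6 ∷ # 3 ∷ # 5 ∷ # 10 ∷ # 10 ∷ # 8 ∷ # 11 ∷ # 6 ∷ # 12 ∷ # 9 ∷ # 0 ∷ # 1 ∷ []) ∷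
  (# 1 ∷ # 9 ∷ # 10 ∷ # 12 ∷ # 4 ∷ # 2 ∷ # 11 ∷ # 8 ∷ # 6 ∷ # 5 ∷ # 3 ∷ # 2 ∷ # 8 ∷ # 0 ∷ # 7 ∷ # 4 ∷ []) ∷
  (# 7 ∷ # 9 ∷ # 6 ∷ # 4 ∷ # 2 ∷ # 8 ∷ # 0 ∷ # 3 ∷ # 0 ∷ # 5 ∷ # 12 ∷ # 10 ∷ # 9 ∷ # 1 ∷ # 8 ∷ # 6 ∷ []) ∷
  (# 8 ∷ # 10 ∷ # 1 ∷ # 2 ∷ # 4 ∷ # 12 ∷ # 5 ∷ # 11 ∷ # 3 ∷ # 4 ∷ # 11 ∷ # 0 ∷ # 6 ∷ # 2 ∷ # 10 ∷ # 7 ∷ []) ∷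
  (# 5 ∷ # 6 ∷ # 10 ∷ # 1 ∷ # 1 ∷ # 0 ∷ # 11 ∷ # 12 ∷ # 11 ∷ # 12 ∷ # 7 ∷ # 2 ∷ # 10 ∷ # 7 ∷ # 3 ∷ # 4 ∷ []) ∷
  (# 2 ∷ # 3 ∷ # 4 ∷ # 7 ∷ # 7 ∷ # 9 ∷ # 8 ∷ # 10 ∷ # 9 ∷ # 1 ∷ # 6 ∷ # 8 ∷ # 0 ∷ # 11 ∷ # 1 ∷ # 5 ∷ []) ∷
  (# 10 ∷ # 1 ∷ # 9 ∷ # 11 ∷ # 5 ∷ # 4 ∷ # 1 ∷ # 2 ∷ # 8 ∷ # 6 ∷ # 3 ∷ # 7 ∷ # 7 ∷ # 10 ∷ # 11 ∷ # 0 ∷ []) ∷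
  (# 6 ∷ # 7 ∷ # 12 ∷ # 8 ∷ # 0 ∷ # 3 ∷ # 7 ∷ # 9 ∷ # 1 ∷ # 9 ∷ # 2 ∷ # 5 ∷ # 12 ∷ # 8 ∷ # 4 ∷ # 1 ∷ []) ∷
  (# 12 ∷ # 2 ∷ # 8 ∷ # 3 ∷ # 9 ∷ # 11 ∷ # 4 ∷ # 7 ∷ # 4 ∷ # 0 ∷ # 1 ∷ # 9 ∷ # 2 ∷ # 5 ∷ # 6 ∷ # 8 ∷ []) ∷
  (# 11 ∷ # 4 ∷ # 5 ∷ # 6 ∷ # 10 ∷ # 1 ∷ # 2 ∷ # 0 ∷ # 7 ∷ # 10 ∷ # 0 ∷ # 11 ∷ # 3 ∷ # 6 ∷ # 9 ∷ # 12 ∷ []) ∷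
  []

colouring₈ : Word 8 → Fin 13
colouring₈ u = lookupWord (lookupWord colours₈ (take 4 u)) (drop 4 u)

χ₂≤8,13 : χ₂≤ 8 13
χ₂≤8,13 = colouring₈ , toWitness {a? = isProperColouring? 8 13 colouring₈} _

a*2^[1+i]≡2*[a*2^i] : ∀ a i → a * 2 ^ suc i ≡ 2 * (a * 2 ^ i)
a*2^[1+i]≡2*[a*2^i] a i =
  trans (sym (*-assoc a 2 (2 ^ i))) (trans (cong (_* 2 ^ i) (*-comm a 2)) (*-assoc 2 a (2 ^ i)))

2*a∸1≡1+[a∸1]+[a∸1] : ∀ a → .{{NonZero a}} → 2 * a ∸ 1 ≡ suc ((a ∸ 1) + (a ∸ 1))
2*a∸1≡1+[a∸1]+[a∸1] (suc a) = trans (+-suc a (a + 0)) (cong (λ x → suc (a + x)) (+-identityʳ a))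

theorem5 : ∀ (i : ℕ) → χ₂≤ (9 * 2 ^ i ∸ 1) (13 * 2 ^ i)
theorem5 zero    = χ₂≤8,13
theorem5 (suc i) = subst₂ χ₂≤ length≡ (sym (a*2^[1+i]≡2*[a*2^i] 13 i)) (doubling (theorem5 i))
  where
  length≡ : suc ((9 * 2 ^ i ∸ 1) + (9 * 2 ^ i ∸ 1)) ≡ 9 * 2 ^ suc i ∸ 1
  length≡ = sym (trans (cong (_∸ 1) (a*2^[1+i]≡2*[a*2^i] 9 i))
                       (2*a∸1≡1+[a∸1]+[a∸1] (9 * 2 ^ i) {{m*n≢0 9 (2 ^ i) {{_}} {{m^n≢0 2 i}}}}))
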